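{- Let $\mathcal M_1=(W_1,\preccurlyeq_1,S_1,V_1)$ and $\mathcal M_2=(W_2,\preccurlyeq_2,S_2,V_2)$ be models and $\mathcal Z_n\subseteq\cdots\subseteq\mathcal Z_0$ a bounded $\mathcal R$-bisimulation between them. Then for all $m\le n$ and $(w_1,w_2)\in W_1\times W_2$, if $w_1\mathcal Z_mw_2$, then for every $\varphi\in\mathcal L_{\mathcal R}$ with $|\varphi|\le m$, $\mathcal M_1,w_1\models\varphi$ iff $\mathcal M_2,w_2\models\varphi$.
   Context: A model is $(W,\preccurlyeq,S,V)$ with $\preccurlyeq$ a partial order on $W\ne\emptyset$, $S:W\to W$ satisfying $w\preccurlyeq v\Rightarrow S(w)\preccurlyeq S(v)$, and $V$ assigning each world a set of propositional variables, monotone along $\preccurlyeq$. $\mathcal L_{\mathcal R}$ is the set of formulas built from variables and $\bot$ using $\wedge,\vee,\to,\bigcirc,\mathcal R$. Satisfaction: $w\models p$ iff $p\in V(w)$; $w\not\models\bot$; $\wedge,\vee$ classical; $w\models\varphi\to\psi$ iff for all $v\succcurlyeq w$, $v\models\varphi$ implies $v\models\psi$; $w\models\bigcirc\varphi$ iff $S(w)\models\varphi$; $w\models\varphi\,\mathcal R\,\psi$ iff for all $k\ge0$, either $S^k(w)\models\psi$ or $S^i(w)\models\varphi$ for some $i\in[0,k)$. Length: $|p|=|\bot|=0$; $|\varphi\odot\psi|=1+|\varphi|+|\psi|$ for binary $\odot$; $|\odot\psi|=1+|\psi|$ for unary $\odot$. For $n>0$, a bounded $\bigcirc$-bisimulation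 is a sequence $\mathcal Z_n\subseteq\cdots\subseteq\mathcal Z_0\subseteq W_1\times W_2$ such that for all $0\le i<n$: if $w_1\mathcal Z_iw_2$ then $w_1,w_2$ satisfy the same variables; if $w_1\mathcal Z_{i+1}w_2$ then every $v_1\succcurlyeq w_1$ has some $v_2\succcurlyeq w_2$ with $v_1\mathcal Z_iv_2$, every $v_2\succcurlyeq w_2$ has some $v_1\succcurlyeq w_1$ with $v_1\mathcal Z_iv_2$, and $S_1(w_1)\mathcal Z_iS_2(w_2)$. It is a bounded $\mathcal R$-bisimulation if moreover, for all $0\le i<n$ and $w_1\mathcal Z_{i+1}w_2$: (Forth $\mathcal R$) for every $k_2\ge0$ there are $k_1\ge0$ and $(v_1,v_2)\in W_1\times W_2$ with $S_2^{k_2}(w_2)\succcurlyeq v_2$, $v_1\succcurlyeq S_1^{k_1}(w_1)$, $v_1\mathcal Z_iv_2$, and such that for every $j_1\in[0,k_1)$ there are $j_2\in[0,k_2)$ and $(u_1,u_2)$ with $u_1\succcurlyeq S_1^{j_1}(w_1)$, $S_2^{j_2}(w_2)\succcurlyeq u_2$, $u_1\mathcal Z_iu_2$; (Back $\mathcal R$) for every $k_1\ge0$ there are $k_2\ge0$ and $(v_1,v_2)$ with $S_1^{k_1}(w_1)\succcurlyeq v_1$, $v_2\succcurlyeq S_2^{k_2}(w_2)$, $v_1\mathcal Z_iv_2$, and such that for every $j_2\in[0,k_2)$ there are $j_1\in[0,k_1)$ and $(u_1,u_2)$ with $u_2\succcurlyeq S_2^{j_2}(w_2)$, $S_1^{j_1}(w_1)\succcurlyeq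 u_1$, $u_1\mathcal Z_iu_2$. -}

module Defs where

open import Level using (Level; _⊔_) renaming (suc to lsuc)
open import Data.Nat using (ℕ; zero; suc; _+_; _<_; _≤_)
open import Data.Product using (Σ; _×_; _,_; ∃; ∃-syntax)
open import Data.Sum using (_⊎_)
open import Data.Empty using (⊥)
open import Function using (_⇔_)
open import Relation.Binary.PropositionalEquality using (_≡_)
open import Relation.Binary.Structures using (IsPartialOrder)

Var : Set
Var = ℕ

data Form : Set where
  var  : Var → Form
  ⊥'   : Form
  _∧'_ : Form → Form → Form
  _∨'_ : Form → Form → Form
  _⇒'_ : Form → Form → Form
  ○_   : Form → Form
  _R'_ : Form → Form → Form

len : Form → ℕ
len (var p)  = 0
len ⊥'       = 0
len (φ ∧' ψ) = suc (len φ + len ψ)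
len (φ ∨' ψ) = suc (len φ + len ψ)
len (φ ⇒' ψ) = suc (len φ + len ψ)
len (○ φ)    = suc (len φ)
len (φ R' ψ) = suc (len φ + len ψ)

iter : ∀ {a} {A : Set a} → (A → A) → ℕ → A → A
iter f zero    x = x
iter f (suc k) x = f (iter f k x)

record Model (a ℓ : Level) : Set (lsuc (a ⊔ ℓ)) where
  field
    W        : Set a
    inhabited : W
    _≼_      : W → W → Set ℓ
    isPO     : IsPartialOrder _≡_ _≼_
    S        : W → W
    S-mono   : ∀ {w v} → w ≼ v → S w ≼ S v
    V        : W → Var → Set ℓ
    V-mono   : ∀ {w v} p → w ≼ v → V w p → V v p

module _ {a ℓ : Level} (M : Model a ℓ) where
  open Model M

  Sat : W → Form → Set (a ⊔ ℓ)
  Sat w (var p)  = Level.Lift a (V w p)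
  Sat w ⊥'       = Level.Lift (a ⊔ ℓ) ⊥
  Sat w (φ ∧' ψ) = Sat w φ × Sat w ψ
  Sat w (φ ∨' ψ) = Sat w φ ⊎ Sat w ψ
  Sat w (φ ⇒' ψ) = ∀ v → w ≼ v → Sat v φ → Sat v ψ
  Sat w (○ φ)    = Sat (S w) φ
  Sat w (φ R' ψ) = ∀ (k : ℕ) → Sat (iter S k w) ψ ⊎ (Σ ℕ λ i → i < k × Sat (iter S i w) φ)

record IsBoundedRBisim {a ℓ z : Level} (M₁ M₂ : Model a ℓ) (n : ℕ)
       (Z : ℕ → Model.W M₁ → Model.W M₂ → Set z) : Set (a ⊔ ℓ ⊔ z) where
  open Model M₁ renaming (W to W₁; _≼_ to _≼₁_; S to S₁; V to V₁)
  open Model M₂ renaming (W to W₂; _≼_ to _≼₂_; S to S₂; V to V₂)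
  field
    nonzero : 0 < n
    decr  : ∀ i → i < n → ∀ {w₁ w₂} → Z (suc i) w₁ w₂ → Z i w₁ w₂
    atoms : ∀ i → i < n → ∀ {w₁ w₂} → Z i w₁ w₂ → ∀ p → V₁ w₁ p ⇔ V₂ w₂ p
    forthI : ∀ i → i < n → ∀ {w₁ w₂} → Z (suc i) w₁ w₂ →
             ∀ v₁ → w₁ ≼₁ v₁ → Σ W₂ λ v₂ → w₂ ≼₂ v₂ × Z i v₁ v₂
    backI  : ∀ i → i < n → ∀ {w₁ w₂} → Z (suc i) w₁ w₂ →
             ∀ v₂ → w₂ ≼₂ v₂ → Σ W₁ λ v₁ → w₁ ≼₁ v₁ × Z i v₁ v₂
    next  : ∀ i → i < n → ∀ {w₁ w₂} → Z (suc i) w₁ w₂ → Z i (S₁ w₁) (S₂ w₂)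
    forthR : ∀ i → i < n → ∀ {w₁ w₂} → Z (suc i) w₁ w₂ →
             ∀ (k₂ : ℕ) → Σ ℕ λ k₁ → Σ W₁ λ v₁ → Σ W₂ λ v₂ →
               (v₂ ≼₂ iter S₂ k₂ w₂) × (iter S₁ k₁ w₁ ≼₁ v₁) × Z i v₁ v₂ ×
               (∀ j₁ → j₁ < k₁ → Σ ℕ λ j₂ → j₂ < k₂ × Σ W₁ λ u₁ → Σ W₂ λ u₂ →
                  (iter S₁ j₁ w₁ ≼₁ u₁) × (u₂ ≼₂ iter S₂ j₂ w₂) × Z i u₁ u₂)
    backR : ∀ i → i < n → ∀ {w₁ w₂} → Z (suc i) w₁ w₂ →
             ∀ (k₁ : ℕ) → Σ ℕ λ k₂ → Σ W₁ λ v₁ → Σ W₂ λ v₂ →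
               (v₁ ≼₁ iter S₁ k₁ w₁) × (iter S₂ k₂ w₂ ≼₂ v₂) × Z i v₁ v₂ ×
               (∀ j₂ → j₂ < k₂ → Σ ℕ λ j₁ → j₁ < k₁ × Σ W₁ λ u₁ → Σ W₂ λ u₂ →
                  (iter S₂ j₂ w₂ ≼₂ u₂) × (u₁ ≼₁ iter S₁ j₁ w₁) × Z i u₁ u₂)

module Submission where

-- The clauses (Forth R)/(Back R) of a bounded R-bisimulation, combined with
-- the zig-zag lemma, produce exactly the hypothesis of the transfer
-- principle, which settles the R case; the atom, ∧, ∨, →, ○ cases are the
-- usual bisimulation arguments.

open import Defs
open import Level using (Level; _⊔_; Lift; lift)
open import Data.Nat using (ℕ; zero; suc; _<_; _≤_; s≤s)
open import Data.Nat.Properties using (m+n≤o⇒m≤o; m+n≤o⇒n≤o; <⇒≤)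
open import Data.Product using (Σ; _×_; _,_)
open import Data.Product.Function.NonDependent.Propositional using (_×-⇔_)
open import Data.Sum using (_⊎_; inj₁; inj₂)
open import Data.Sum.Function.Propositional using (_⊎-⇔_)
open import Function using (_∘_; _⇔_; mk⇔; Equivalence)
open import Relation.Binary.Structures using (IsPartialOrder)

open Equivalence using (to; from)

Release : ∀ {p} (A B : ℕ → Set p) → Set p
Release A B = ∀ k → B k ⊎ Σ ℕ λ i → i < k × A i

ReleaseSim : ∀ {p q} (A₁ B₁ : ℕ → Set p) (A₂ B₂ : ℕ → Set q) → Set (p ⊔ q)
ReleaseSim A₁ B₁ A₂ B₂ =
  ∀ k₂ → Σ ℕ λ k₁ → (B₁ k₁ → B₂ k₂) ×
    (∀ j₁ → j₁ < k₁ → Σ ℕ λ j₂ → j₂ < k₂ × (A₁ j₁ → A₂ j₂))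

release-transfer : ∀ {p q} {A₁ B₁ : ℕ → Set p} {A₂ B₂ : ℕ → Set q} →
  ReleaseSim A₁ B₁ A₂ B₂ → Release A₁ B₁ → Release A₂ B₂
release-transfer sim r k₂ with sim k₂
... | k₁ , transferB , transferA with r k₁
... | inj₁ b = inj₁ (transferB b)
... | inj₂ (j₁ , j₁<k₁ , a) with transferA j₁ j₁<k₁
... | j₂ , j₂<k₂ , a→ = inj₂ (j₂ , j₂<k₂ , a→ a)

module ModelFacts {a ℓ : Level} (M : Model a ℓ) where
  open Model M
  open IsPartialOrder isPO using (trans)

  -- The truth values of φ along the S-orbit of w; by definition
  -- Sat M w (φ R' ψ) is Release (orbit w φ) (orbit w ψ).
  orbit : W → Form → ℕ → Set (a ⊔ ℓ)
  orbit w φ k = Sat M (iter S k w) φ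

  iter-mono : ∀ k {w v} → w ≼ v → iter S k w ≼ iter S k v
  iter-mono zero    w≼v = w≼v
  iter-mono (suc k) w≼v = S-mono (iter-mono k w≼v)

  persistence : ∀ φ {w v} → w ≼ v → Sat M w φ → Sat M v φ
  persistence (var p)  w≼v (lift x)   = lift (V-mono p w≼v x)
  persistence ⊥'       w≼v (lift ())
  persistence (φ ∧' ψ) w≼v (x , y)    = persistence φ w≼v x , persistence ψ w≼v y
  persistence (φ ∨' ψ) w≼v (inj₁ x)   = inj₁ (persistence φ w≼v x)
  persistence (φ ∨' ψ) w≼v (inj₂ y)   = inj₂ (persistence ψ w≼v y)
  persistence (φ ⇒' ψ) w≼v f          = λ u v≼u → f u (trans w≼v v≼u)
  persistence (○ φ)    w≼v x          = persistence φ (S-mono w≼v) x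
  persistence (φ R' ψ) w≼v f k with f k
  ... | inj₁ x             = inj₁ (persistence ψ (iter-mono k w≼v) x)
  ... | inj₂ (i , i<k , x) = inj₂ (i , i<k , persistence φ (iter-mono i w≼v) x)

lift-⇔ : ∀ {p q r} {A : Set p} {B : Set q} → A ⇔ B → Lift r A ⇔ Lift r B
lift-⇔ A⇔B = mk⇔ (λ { (lift x) → lift (to A⇔B x) }) (λ { (lift y) → lift (from A⇔B y) })

module TwoModels {a ℓ z : Level} (M₁ M₂ : Model a ℓ) where
  open Model M₁ using () renaming (W to W₁; _≼_ to _≼₁_)
  open Model M₂ using () renaming (W to W₂; _≼_ to _≼₂_)
  open ModelFacts M₁ using () renaming (persistence to persistence₁)
  open ModelFacts M₂ using () renaming (persistence to persistence₂)

  Agrees : (W₁ → W₂ → Set z) → Form → Set (a ⊔ ℓ ⊔ z)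
  Agrees Rel χ = ∀ {v₁ v₂} → Rel v₁ v₂ → Sat M₁ v₁ χ ⇔ Sat M₂ v₂ χ

  zigzag-forth : ∀ {Rel} χ → Agrees Rel χ → ∀ {x₁ v₁ v₂ x₂} →
    x₁ ≼₁ v₁ → Rel v₁ v₂ → v₂ ≼₂ x₂ → Sat M₁ x₁ χ → Sat M₂ x₂ χ
  zigzag-forth χ agree x₁≼v₁ rel v₂≼x₂ =
    persistence₂ χ v₂≼x₂ ∘ to (agree rel) ∘ persistence₁ χ x₁≼v₁

  zigzag-back : ∀ {Rel} χ → Agrees Rel χ → ∀ {x₁ v₁ v₂ x₂} →
    x₂ ≼₂ v₂ → Rel v₁ v₂ → v₁ ≼₁ x₁ → Sat M₂ x₂ χ → Sat M₁ x₁ χ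
  zigzag-back χ agree x₂≼v₂ rel v₁≼x₁ =
    persistence₁ χ v₁≼x₁ ∘ from (agree rel) ∘ persistence₂ χ x₂≼v₂

module Preservation {a ℓ z : Level} (M₁ M₂ : Model a ℓ) (n : ℕ)
    (Z : ℕ → Model.W M₁ → Model.W M₂ → Set z)
    (bisim : IsBoundedRBisim M₁ M₂ n Z) where
  open IsBoundedRBisim bisim
  open ModelFacts M₁ using () renaming (orbit to orbit₁)
  open ModelFacts M₂ using () renaming (orbit to orbit₂)
  open TwoModels {z = z} M₁ M₂

  -- Z_m-related worlds satisfy the same variables for every m ≤ n: the atom
  -- clause covers Z_0 (using n > 0) and Z_{i+1} ⊆ Z_i reduces m = i+1 to it.
  atoms-agree : ∀ m → m ≤ n → ∀ p → Agrees (Z m) (var p)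
  atoms-agree zero    _       p rel = lift-⇔ (atoms zero nonzero rel p)
  atoms-agree (suc i) i<n     p rel = lift-⇔ (atoms i i<n (decr i i<n rel) p)

  implication-agrees : ∀ {i} φ ψ → i < n → Agrees (Z i) φ → Agrees (Z i) ψ →
    Agrees (Z (suc i)) (φ ⇒' ψ)
  implication-agrees {i} φ ψ i<n agreeφ agreeψ rel = mk⇔
    (λ f v₂ w₂≼v₂ sφ → let (v₁ , w₁≼v₁ , rel′) = backI i i<n rel v₂ w₂≼v₂ in
       to (agreeψ rel′) (f v₁ w₁≼v₁ (from (agreeφ rel′) sφ)))
    (λ f v₁ w₁≼v₁ sφ → let (v₂ , w₂≼v₂ , rel′) = forthI i i<n rel v₁ w₁≼v₁ in
       from (agreeψ rel′) (f v₂ w₂≼v₂ (to (agreeφ rel′) sφ)))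

  next-agrees : ∀ {i} φ → i < n → Agrees (Z i) φ → Agrees (Z (suc i)) (○ φ)
  next-agrees {i} φ i<n agreeφ rel = agreeφ (next i i<n rel)

  release-forth : ∀ {i} φ ψ → i < n → Agrees (Z i) φ → Agrees (Z i) ψ →
    ∀ {w₁ w₂} → Z (suc i) w₁ w₂ →
    ReleaseSim (orbit₁ w₁ φ) (orbit₁ w₁ ψ) (orbit₂ w₂ φ) (orbit₂ w₂ ψ)
  release-forth {i} φ ψ i<n agreeφ agreeψ rel k₂ with forthR i i<n rel k₂
  ... | k₁ , v₁ , v₂ , v₂≼ , ≼v₁ , relv , earlier =
    k₁ , zigzag-forth ψ agreeψ ≼v₁ relv v₂≼ , earlier-transfer
    where
    earlier-transfer : ∀ j₁ → j₁ < k₁ → Σ ℕ λ j₂ → j₂ < k₂ × (orbit₁ _ φ j₁ → orbit₂ _ φ j₂)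
    earlier-transfer j₁ j₁<k₁ with earlier j₁ j₁<k₁
    ... | j₂ , j₂<k₂ , u₁ , u₂ , ≼u₁ , u₂≼ , relu =
      j₂ , j₂<k₂ , zigzag-forth φ agreeφ ≼u₁ relu u₂≼

  release-back : ∀ {i} φ ψ → i < n → Agrees (Z i) φ → Agrees (Z i) ψ →
    ∀ {w₁ w₂} → Z (suc i) w₁ w₂ →
    ReleaseSim (orbit₂ w₂ φ) (orbit₂ w₂ ψ) (orbit₁ w₁ φ) (orbit₁ w₁ ψ)
  release-back {i} φ ψ i<n agreeφ agreeψ rel k₁ with backR i i<n rel k₁
  ... | k₂ , v₁ , v₂ , v₁≼ , ≼v₂ , relv , earlier =
    k₂ , zigzag-back ψ agreeψ ≼v₂ relv v₁≼ , earlier-transfer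
    where
    earlier-transfer : ∀ j₂ → j₂ < k₂ → Σ ℕ λ j₁ → j₁ < k₁ × (orbit₂ _ φ j₂ → orbit₁ _ φ j₁)
    earlier-transfer j₂ j₂<k₂ with earlier j₂ j₂<k₂
    ... | j₁ , j₁<k₁ , u₁ , u₂ , ≼u₂ , u₁≼ , relu =
      j₁ , j₁<k₁ , zigzag-back φ agreeφ ≼u₂ relu u₁≼

  release-agrees : ∀ {i} φ ψ → i < n → Agrees (Z i) φ → Agrees (Z i) ψ →
    Agrees (Z (suc i)) (φ R' ψ)
  release-agrees φ ψ i<n agreeφ agreeψ rel = mk⇔
    (release-transfer (release-forth φ ψ i<n agreeφ agreeψ rel))
    (release-transfer (release-back φ ψ i<n agreeφ agreeψ rel))

  agrees : ∀ φ m → m ≤ n → len φ ≤ m → Agrees (Z m) φ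
  agrees (var p)  m       m≤n _          = atoms-agree m m≤n p
  agrees ⊥'       m       m≤n _          = λ _ → lift-⇔ (mk⇔ (λ ()) (λ ()))
  agrees (φ ∧' ψ) m       m≤n len≤ rel   =
    agrees φ m m≤n (m+n≤o⇒m≤o (len φ) (<⇒≤ len≤)) rel
      ×-⇔ agrees ψ m m≤n (m+n≤o⇒n≤o (len φ) (<⇒≤ len≤)) rel
  agrees (φ ∨' ψ) m       m≤n len≤ rel   =
    agrees φ m m≤n (m+n≤o⇒m≤o (len φ) (<⇒≤ len≤)) rel
      ⊎-⇔ agrees ψ m m≤n (m+n≤o⇒n≤o (len φ) (<⇒≤ len≤)) rel
  agrees (φ ⇒' ψ) (suc i) i<n (s≤s len≤) =
    implication-agrees φ ψ i<n (agrees φ i (<⇒≤ i<n) (m+n≤o⇒m≤o (len φ) len≤))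
                               (agrees ψ i (<⇒≤ i<n) (m+n≤o⇒n≤o (len φ) len≤))
  agrees (○ φ)    (suc i) i<n (s≤s len≤) =
    next-agrees φ i<n (agrees φ i (<⇒≤ i<n) len≤)
  agrees (φ R' ψ) (suc i) i<n (s≤s len≤) =
    release-agrees φ ψ i<n (agrees φ i (<⇒≤ i<n) (m+n≤o⇒m≤o (len φ) len≤))
                           (agrees ψ i (<⇒≤ i<n) (m+n≤o⇒n≤o (len φ) len≤))

mainTheorem15 : {a ℓ z : Level} (M₁ M₂ : Model a ℓ) (n : ℕ)
    (Z : ℕ → Model.W M₁ → Model.W M₂ → Set z) →
    IsBoundedRBisim M₁ M₂ n Z →
    ∀ m → m ≤ n → ∀ (w₁ : Model.W M₁) (w₂ : Model.W M₂) → Z m w₁ w₂ →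
    ∀ (φ : Form) → len φ ≤ m → Sat M₁ w₁ φ ⇔ Sat M₂ w₂ φ
mainTheorem15 M₁ M₂ n Z bisim m m≤n w₁ w₂ rel φ len≤m =
  Preservation.agrees M₁ M₂ n Z bisim φ m m≤n len≤m rel
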